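{- For $i\ge 1$ let $G_i$ be the cycle of length $2i+1$. Then for all $k,m\ge 1$ with $k\neq m$, $\mathrm{Par}^*(G_k)\cap\mathrm{Par}^*(G_m)=\emptyset$ (as sets of graphs up to isomorphism).
   Context: For a graph $G=(V,E)$, $\mathrm{Par}(G)$ is the set of graphs obtained by adding a new vertex $u\notin V$ and the edges $\{\{u,v'\}: v'\in N_G(v)\cup\{v\}\}$ for some $v\in V$, where $N_G(v)$ is the neighborhood of $v$; $\mathrm{Par}^0(G)=\{G\}$, $\mathrm{Par}^k(G)=\bigcup_{H\in\mathrm{Par}^{k-1}(G)}\mathrm{Par}(H)$, $\mathrm{Par}^*(G)=\bigcup_{k\ge 0}\mathrm{Par}^k(G)$. -}

module Defs where

open import Data.Nat using (ℕ; zero; suc; _+_; _%_; _≡ᵇ_)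
open import Data.Fin using (Fin; zero; suc; toℕ; _≟_)
open import Data.Bool using (Bool; true; false; _∨_)
open import Relation.Nullary using (does)
open import Relation.Binary.PropositionalEquality using (_≡_)
open import Function.Bundles using (_↔_; Inverse)

-- A finite graph on vertex set Fin n, given by a Bool-valued adjacency
-- relation.  (All graphs considered below -- odd cycles and graphs obtained
-- from them by Par -- are simple: symmetric and irreflexive adjacency.)
record Graph : Set where
  constructor mkGraph
  field
    n   : ℕ
    adj : Fin n → Fin n → Bool

open Graph public

closedNbr : (G : Graph) → Fin (n G) → Fin (n G) → Bool
closedNbr G v w = does (v ≟ w) ∨ adj G v w

parAdj : (G : Graph) → Fin (n G) → Fin (suc (n G)) → Fin (suc (n G)) → Bool
parAdj G v zero    zero    = false
parAdj G v zero    (suc w) = closedNbr G v w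
parAdj G v (suc w) zero    = closedNbr G v w
parAdj G v (suc a) (suc b) = adj G a b

par : (G : Graph) → Fin (n G) → Graph
par G v = mkGraph (suc (n G)) (parAdj G v)

data ParStar (G : Graph) : Graph → Set where
  base : ParStar G G
  step : ∀ {H} → ParStar G H → (v : Fin (n H)) → ParStar G (par H v)

record _≅_ (G H : Graph) : Set where
  field
    bij      : Fin (n G) ↔ Fin (n H)
    preserve : ∀ a b → adj G a b ≡ adj H (Inverse.to bij a) (Inverse.to bij b)

cycleAdj : (N' : ℕ) → Fin (suc N') → Fin (suc N') → Bool
cycleAdj N' a b = (toℕ b ≡ᵇ (suc (toℕ a) % suc N'))
                ∨ (toℕ a ≡ᵇ (suc (toℕ b) % suc N'))

oddCycle : ℕ → Graph
oddCycle i = mkGraph (suc (i + i)) (cycleAdj (i + i))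

-- A Par step adds a closed twin of an existing vertex, so every graph in Par*(G)
-- (G undirected) maps to V(G) with every fibre consisting of pairwise closed twins.
-- Par*(G) also contains G as an induced subgraph, and a cycle of length at least 4
-- has no two distinct closed twins.  If k < m and some H ∈ Par*(G_k) were
-- isomorphic to a graph in Par*(G_m), the 2m+1 vertices of the induced copy of G_m
-- in H would fall into at most 2k+1 twin classes, and by pigeonhole two of them
-- would be twins already in G_m.
module Submission where

open import Defs
open import Data.Nat using (ℕ; _≤_)
open import Relation.Nullary using (¬_)
open import Relation.Binary.PropositionalEquality using (_≢_)

open import Data.Nat using (zero; suc; _+_; _∸_; _<_; _%_; _≡ᵇ_; NonZero; z≤n; s≤s; s≤s⁻¹; _<?_)
open import Data.Nat.Properties
  using (≡ᵇ⇒≡; ≡⇒≡ᵇ; ≤-trans; <-trans; n≤1+n; n<1+n; <⇒≢; <⇒≱; ≮⇒≥; m<n+m; +-mono-≤; +-mono-<;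
         +-comm; +-cancelʳ-≡; m∸n+n≡m; m<n+o⇒m∸n<o; <-cmp)
open import Data.Nat.DivMod using (_mod_; %-distribˡ-+; m%n%n≡m%n; m%n<n; m<n⇒m%n≡m; m≤n⇒[n∸m]%m≡n%m)
open import Data.Fin using (Fin; zero; suc; toℕ; _≟_)
import Data.Fin.Properties as Fin
open import Data.Bool using (true; T; _∨_)
open import Data.Bool.Properties using (∨-comm; T-∨)
open import Data.Sum using (_⊎_; inj₁; inj₂; map)
open import Data.Product using (_,_)
open import Data.Unit using (tt)
open import Data.Empty using (⊥-elim)
open import Function using (_∘_)
open import Function.Bundles using (Inverse; Injection; Equivalence; mk⇔)
open import Function.Properties.Inverse using (↔-sym; ↔⇒↣)
open import Relation.Nullary using (does; yes; no)
open import Relation.Nullary.Decidable using (dec-true; does-⇔)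
open import Relation.Binary.Definitions using (tri<; tri≈; tri>)
open import Relation.Binary.PropositionalEquality using (_≡_; refl; sym; trans; cong; cong₂; subst; module ≡-Reasoning)

private
  variable
    G H : Graph
    L : ℕ

suc[m%n]%n≡suc[m]%n : ∀ m n .{{_ : NonZero n}} → suc (m % n) % n ≡ suc m % n
suc[m%n]%n≡suc[m]%n m n = begin
  (1 + m % n) % n         ≡⟨ %-distribˡ-+ 1 (m % n) n ⟩
  (1 % n + m % n % n) % n ≡⟨ cong (λ r → (1 % n + r) % n) (m%n%n≡m%n m n) ⟩
  (1 % n + m % n) % n     ≡⟨ %-distribˡ-+ 1 m n ⟨
  (1 + m) % n             ∎
  where open ≡-Reasoning

[k+m]%n≢m : ∀ {k m n} .{{_ : NonZero n}} → 0 < k → k < n → m < n → (k + m) % n ≢ m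
[k+m]%n≢m {k} {m} {n} 0<k k<n m<n eq with k + m <? n
... | yes k+m<n = <⇒≢ (m<n+m m 0<k) (sym (trans (sym (m<n⇒m%n≡m k+m<n)) eq))
... | no  k+m≮n = <⇒≢ k<n (+-cancelʳ-≡ m k n k+m≡n+m)
  where
  n≤k+m = ≮⇒≥ k+m≮n
  r<n : k + m ∸ n < n
  r<n = m<n+o⇒m∸n<o (k + m) n (+-mono-< k<n m<n)
  r≡m : k + m ∸ n ≡ m
  r≡m = trans (sym (m<n⇒m%n≡m r<n)) (trans (m≤n⇒[n∸m]%m≡n%m n≤k+m) eq)
  k+m≡n+m : k + m ≡ n + m
  k+m≡n+m = begin
    k + m         ≡⟨ m∸n+n≡m n≤k+m ⟨
    k + m ∸ n + n ≡⟨ cong (_+ n) r≡m ⟩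
    m + n         ≡⟨ +-comm m n ⟩
    n + m         ∎
    where open ≡-Reasoning

Symmetric : Graph → Set
Symmetric G = ∀ a b → adj G a b ≡ adj G b a

ClosedTwins : (G : Graph) → Fin (n G) → Fin (n G) → Set
ClosedTwins G a b = ∀ w → closedNbr G a w ≡ closedNbr G b w

TwinFree : Graph → Set
TwinFree G = ∀ a b → ClosedTwins G a b → a ≡ b

closedNbr-refl : ∀ a → closedNbr G a a ≡ true
closedNbr-refl {G} a = cong (_∨ adj G a a) (dec-true (a ≟ a) refl)

closedNbr-sym : Symmetric G → ∀ a b → closedNbr G a b ≡ closedNbr G b a
closedNbr-sym sym-adj a b = cong₂ _∨_ (does-⇔ (mk⇔ sym sym) (a ≟ b) (b ≟ a)) (sym-adj a b)

record TwinClassMap (G : Graph) (L : ℕ) : Set where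
  field
    class : Fin (n G) → Fin L
    twins : ∀ a b → class a ≡ class b → ClosedTwins G a b

par-symmetric : Symmetric G → (v : Fin (n G)) → Symmetric (par G v)
par-symmetric sym-adj v zero    zero    = refl
par-symmetric sym-adj v zero    (suc b) = refl
par-symmetric sym-adj v (suc a) zero    = refl
par-symmetric sym-adj v (suc a) (suc b) = sym-adj a b

parStar-symmetric : Symmetric G → ParStar G H → Symmetric H
parStar-symmetric sym-G base       = sym-G
parStar-symmetric sym-G (step s v) = par-symmetric (parStar-symmetric sym-G s) v

par-twinClassMap : Symmetric G → TwinClassMap G L → (v : Fin (n G)) → TwinClassMap (par G v) L
par-twinClassMap {G} {L} sym-adj c v = record { class = class′ ; twins = twins′ }
  where
  open TwinClassMap c
  class′ : Fin (suc (n G)) → Fin L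
  class′ zero    = class v
  class′ (suc a) = class a
  new-twin : ∀ b → class v ≡ class b → ClosedTwins (par G v) zero (suc b)
  new-twin b e zero    = sym (trans (twins v b e b) (closedNbr-refl {G} b))
  new-twin b e (suc w) = twins v b e w
  twins′ : ∀ a b → class′ a ≡ class′ b → ClosedTwins (par G v) a b
  twins′ zero    zero    _ w       = refl
  twins′ zero    (suc b) e         = new-twin b e
  twins′ (suc a) zero    e w       = sym (new-twin a (sym e) w)
  twins′ (suc a) (suc b) e zero    = begin
    closedNbr G v a ≡⟨ closedNbr-sym sym-adj v a ⟩
    closedNbr G a v ≡⟨ twins a b e v ⟩
    closedNbr G b v ≡⟨ closedNbr-sym sym-adj b v ⟩
    closedNbr G v b ∎
    where open ≡-Reasoning
  twins′ (suc a) (suc b) e (suc w) = twins a b e w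

parStar-twinClassMap : Symmetric G → ParStar G H → TwinClassMap H (n G)
parStar-twinClassMap sym-G base       = record { class = λ a → a ; twins = λ { a .a refl w → refl } }
parStar-twinClassMap sym-G (step s v) =
  par-twinClassMap (parStar-symmetric sym-G s) (parStar-twinClassMap sym-G s) v

≅-sym : G ≅ H → H ≅ G
≅-sym {G} {H} iso = record
  { bij      = ↔-sym bij
  ; preserve = λ a b → begin
      adj H a b                         ≡⟨ cong₂ (adj H) (strictlyInverseˡ a) (strictlyInverseˡ b) ⟨
      adj H (to (from a)) (to (from b)) ≡⟨ preserve (from a) (from b) ⟨
      adj G (from a) (from b)           ∎
  }
  where
  open _≅_ iso
  open Inverse bij using (to; from; strictlyInverseˡ)
  open ≡-Reasoning

record InducedEmbedding (G H : Graph) : Set where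
  field
    to            : Fin (n G) → Fin (n H)
    injective     : ∀ {a b} → to a ≡ to b → a ≡ b
    adj-preserved : ∀ a b → adj H (to a) (to b) ≡ adj G a b

  closedNbr-preserved : ∀ a b → closedNbr H (to a) (to b) ≡ closedNbr G a b
  closedNbr-preserved a b =
    cong₂ _∨_ (does-⇔ (mk⇔ injective (cong to)) (to a ≟ to b) (a ≟ b)) (adj-preserved a b)

  ClosedTwins-reflected : ∀ a b → ClosedTwins H (to a) (to b) → ClosedTwins G a b
  ClosedTwins-reflected a b twins w = begin
    closedNbr G a w           ≡⟨ closedNbr-preserved a w ⟨
    closedNbr H (to a) (to w) ≡⟨ twins (to w) ⟩
    closedNbr H (to b) (to w) ≡⟨ closedNbr-preserved b w ⟩
    closedNbr G b w           ∎
    where open ≡-Reasoning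

open InducedEmbedding

embedding-refl : InducedEmbedding G G
embedding-refl = record { to = λ a → a ; injective = λ e → e ; adj-preserved = λ a b → refl }

embedding-trans : InducedEmbedding G H → ∀ {K} → InducedEmbedding H K → InducedEmbedding G K
embedding-trans e f = record
  { to            = to f ∘ to e
  ; injective     = injective e ∘ injective f
  ; adj-preserved = λ a b → trans (adj-preserved f (to e a) (to e b)) (adj-preserved e a b)
  }

par-embedding : (v : Fin (n G)) → InducedEmbedding G (par G v)
par-embedding v = record { to = suc ; injective = Fin.suc-injective ; adj-preserved = λ a b → refl }

parStar-embedding : ParStar G H → InducedEmbedding G H
parStar-embedding base       = embedding-refl
parStar-embedding (step s v) = embedding-trans (parStar-embedding s) (par-embedding v)

≅⇒embedding : G ≅ H → InducedEmbedding G H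
≅⇒embedding iso = record
  { to            = Inverse.to bij
  ; injective     = Injection.injective (↔⇒↣ bij)
  ; adj-preserved = λ a b → sym (preserve a b)
  }
  where open _≅_ iso

twinFree-embedding⇒n≤ : TwinFree G → InducedEmbedding G H → TwinClassMap H L → n G ≤ L
twinFree-embedding⇒n≤ twinFree e c = ≮⇒≥ λ L<n →
  let i , j , i<j , same-class = Fin.pigeonhole L<n (class ∘ to e)
  in  Fin.<⇒≢ i<j (twinFree i j (ClosedTwins-reflected e i j (twins (to e i) (to e j) same-class)))
  where open TwinClassMap c

cycleGraph : ℕ → Graph
cycleGraph N = mkGraph (suc N) (cycleAdj N)

cycleGraph-symmetric : ∀ N → Symmetric (cycleGraph N)
cycleGraph-symmetric N a b = ∨-comm (toℕ b ≡ᵇ suc (toℕ a) % suc N) (toℕ a ≡ᵇ suc (toℕ b) % suc N)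

closedNbr-cycleGraph⁻ : ∀ {N} (a w : Fin (suc N)) → T (closedNbr (cycleGraph N) a w) →
                        a ≡ w ⊎ toℕ w ≡ suc (toℕ a) % suc N ⊎ toℕ a ≡ suc (toℕ w) % suc N
closedNbr-cycleGraph⁻ a w a~w with a ≟ w
... | yes a≡w = inj₁ a≡w
... | no  _   = inj₂ (map (≡ᵇ⇒≡ _ _) (≡ᵇ⇒≡ _ _) (Equivalence.to T-∨ a~w))

closedNbr-cycleGraph⁺ : ∀ {N} (a w : Fin (suc N)) → toℕ w ≡ suc (toℕ a) % suc N →
                        T (closedNbr (cycleGraph N) a w)
closedNbr-cycleGraph⁺ a w w≡a+1 =
  Equivalence.from (T-∨ {does (a ≟ w)}) (inj₂ (Equivalence.from T-∨ (inj₁ (≡⇒≡ᵇ _ _ w≡a+1))))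

-- w = a + 2 is adjacent to b = a + 1, but modulo a length ≥ 4 it is neither a,
-- nor a + 1, nor a − 1.
successor-not-twin : ∀ {N} → 3 ≤ N → (a b : Fin (suc N)) → toℕ b ≡ suc (toℕ a) % suc N →
                     ¬ ClosedTwins (cycleGraph N) a b
successor-not-twin {N} 3≤N a b b≡a+1 twins = w∉N[a] (closedNbr-cycleGraph⁻ a w w∈N[a])
  where
  open ≡-Reasoning
  len = suc N
  a<len : toℕ a < len
  a<len = Fin.toℕ<n a
  3<len : 3 < len
  3<len = s≤s 3≤N
  2<len : 2 < len
  2<len = <-trans (n<1+n 2) 3<len
  1<len : 1 < len
  1<len = <-trans (n<1+n 1) 2<len
  w : Fin len
  w = (2 + toℕ a) mod len
  w≡a+2 : toℕ w ≡ (2 + toℕ a) % len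
  w≡a+2 = Fin.toℕ-fromℕ< _
  w≡b+1 : toℕ w ≡ suc (toℕ b) % len
  w≡b+1 = begin
    toℕ w                         ≡⟨ w≡a+2 ⟩
    (2 + toℕ a) % len             ≡⟨ suc[m%n]%n≡suc[m]%n (suc (toℕ a)) len ⟨
    suc (suc (toℕ a) % len) % len ≡⟨ cong (λ x → suc x % len) b≡a+1 ⟨
    suc (toℕ b) % len             ∎
  w∈N[a] : T (closedNbr (cycleGraph N) a w)
  w∈N[a] = subst T (sym (twins w)) (closedNbr-cycleGraph⁺ b w w≡b+1)
  w∉N[a] : ¬ (a ≡ w ⊎ toℕ w ≡ suc (toℕ a) % len ⊎ toℕ a ≡ suc (toℕ w) % len)
  w∉N[a] (inj₁ a≡w) = [k+m]%n≢m (s≤s z≤n) 2<len a<len (sym (trans (cong toℕ a≡w) w≡a+2))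
  w∉N[a] (inj₂ (inj₁ w≡a+1)) = [k+m]%n≢m (s≤s z≤n) 1<len (m%n<n (suc (toℕ a)) len) (begin
    suc (suc (toℕ a) % len) % len ≡⟨ suc[m%n]%n≡suc[m]%n (suc (toℕ a)) len ⟩
    (2 + toℕ a) % len             ≡⟨ w≡a+2 ⟨
    toℕ w                         ≡⟨ w≡a+1 ⟩
    suc (toℕ a) % len             ∎)
  w∉N[a] (inj₂ (inj₂ a≡w+1)) = [k+m]%n≢m (s≤s z≤n) 3<len a<len (sym (begin
    toℕ a                         ≡⟨ a≡w+1 ⟩
    suc (toℕ w) % len             ≡⟨ cong (λ x → suc x % len) w≡a+2 ⟩
    suc ((2 + toℕ a) % len) % len ≡⟨ suc[m%n]%n≡suc[m]%n (2 + toℕ a) len ⟩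
    (3 + toℕ a) % len             ∎))

cycleGraph-twinFree : ∀ {N} → 3 ≤ N → TwinFree (cycleGraph N)
cycleGraph-twinFree {N} 3≤N a b twins
  with closedNbr-cycleGraph⁻ a b (subst T (sym (trans (twins b) (closedNbr-refl {cycleGraph N} b))) tt)
... | inj₁ a≡b          = a≡b
... | inj₂ (inj₁ b≡a+1) = ⊥-elim (successor-not-twin 3≤N a b b≡a+1 twins)
... | inj₂ (inj₂ a≡b+1) = ⊥-elim (successor-not-twin 3≤N b a a≡b+1 (λ w → sym (twins w)))

longer-oddCycle-not-embeddable : ∀ {k m} → 1 ≤ k → k < m → ParStar (oddCycle k) H →
                                 ¬ InducedEmbedding (oddCycle m) H
longer-oddCycle-not-embeddable {H} {k} {m} 1≤k k<m s e =
  <⇒≱ (+-mono-< k<m k<m) (s≤s⁻¹ (twinFree-embedding⇒n≤ oddCycle-twinFree e twinClasses))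
  where
  2≤m : 2 ≤ m
  2≤m = ≤-trans (s≤s 1≤k) k<m
  oddCycle-twinFree : TwinFree (oddCycle m)
  oddCycle-twinFree = cycleGraph-twinFree (≤-trans (n≤1+n 3) (+-mono-≤ 2≤m 2≤m))
  twinClasses : TwinClassMap H (suc (k + k))
  twinClasses = parStar-twinClassMap (cycleGraph-symmetric (k + k)) s

corollary5 : (k m : ℕ) → 1 ≤ k → 1 ≤ m → k ≢ m →
    (H₁ H₂ : Graph) → ParStar (oddCycle k) H₁ → ParStar (oddCycle m) H₂ →
    ¬ (H₁ ≅ H₂)
corollary5 k m 1≤k 1≤m k≢m H₁ H₂ s₁ s₂ H₁≅H₂ with <-cmp k m
... | tri< k<m _ _ = longer-oddCycle-not-embeddable 1≤k k<m s₁
                       (embedding-trans (parStar-embedding s₂) (≅⇒embedding (≅-sym H₁≅H₂)))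
... | tri≈ _ k≡m _ = k≢m k≡m
... | tri> _ _ m<k = longer-oddCycle-not-embeddable 1≤m m<k s₂
                       (embedding-trans (parStar-embedding s₁) (≅⇒embedding H₁≅H₂))
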